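{- Let $\bar\Lambda,\Lambda:\mathbb C[[x]]\to\mathbb C[[x]]$ be defined by $\bar\Lambda=\sum_{k\ge1}x_kS^k$ and $\Lambda=\sum_{k\ge1}x_kS^{k-1}$. Then (a) $\bar\Lambda$ and $\Lambda$ are injective; (b) $\bar\Lambda(1)=\Lambda(1)=\sum_{k\ge1}x_k$.
   Context: $x=(x_1,x_2,\dots)$ is a sequence of commuting variables and $\mathbb C[[x]]$ is the algebra of formal power series in the $x_k$ over $\mathbb C$. The shift operator $S:\mathbb C[[x]]\to\mathbb C[[x]]$ is the unique $\mathbb C$-algebra homomorphism (continuous, acting on series termwise) with $S(1)=1$ and $S(x_m)=x_{m+1}$ for all $m\ge1$. In $x_kS^k$, $x_k$ denotes the operator of multiplication by $x_k$. -}

module Defs where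

open import Level using (Level)
open import Algebra.Bundles using (CommutativeRing)
open import Data.Nat using (ℕ; zero; suc)
open import Data.List using (List; []; _∷_; length)
open import Data.Bool using (Bool; true; false; T; if_then_else_)
open import Data.Maybe using (Maybe; just; nothing)
import Data.Maybe as Maybe
open import Data.Product using (Σ; _,_; proj₁; _×_)
open import Data.Unit using (tt)

-- Monomials in x₁, x₂, … : exponent lists (e₁, e₂, …, eₙ) meaning
-- x₁^e₁ ⋯ xₙ^eₙ, normalised so that the last exponent is nonzero
-- (so each monomial has exactly one representation; [] is 1).

nz : ℕ → Bool
nz zero    = false
nz (suc _) = true

normal? : List ℕ → Bool
normal? []          = true
normal? (x ∷ [])    = nz x
normal? (x ∷ y ∷ l) = normal? (y ∷ l)

Mon : Set
Mon = Σ (List ℕ) (λ l → T (normal? l))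

cons' : ℕ → List ℕ → List ℕ
cons' zero    []      = []
cons' (suc n) []      = suc n ∷ []
cons' zero    (y ∷ r) = zero ∷ y ∷ r
cons' (suc n) (y ∷ r) = suc n ∷ y ∷ r

norm : List ℕ → List ℕ
norm []      = []
norm (x ∷ l) = cons' x (norm l)

cons'-normal : ∀ x l → T (normal? l) → T (normal? (cons' x l))
cons'-normal zero    []      p = tt
cons'-normal (suc n) []      p = tt
cons'-normal zero    (y ∷ r) p = p
cons'-normal (suc n) (y ∷ r) p = p

norm-normal : ∀ l → T (normal? (norm l))
norm-normal []      = tt
norm-normal (x ∷ l) = cons'-normal x (norm l) (norm-normal l)

toMon : List ℕ → Mon
toMon l = norm l , norm-normal l

-- decAt i m : the exponent list of m / x_{i+1}, if x_{i+1} divides m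
decAt : ℕ → List ℕ → Maybe (List ℕ)
decAt _       []          = nothing
decAt zero    (zero ∷ l)  = nothing
decAt zero    (suc e ∷ l) = just (e ∷ l)
decAt (suc i) (e ∷ l)     = Maybe.map (e ∷_) (decAt i l)

isVar : List ℕ → Bool
isVar []               = false
isVar (zero ∷ l)       = isVar l
isVar (suc zero ∷ [])  = true
isVar (suc zero ∷ _ ∷ _) = false
isVar (suc (suc _) ∷ _)  = false

module PowerSeries {c ℓ : Level} (R : CommutativeRing c ℓ) where
  open CommutativeRing R

  Series : Set c
  Series = Mon → Carrier

  _≈ₛ_ : Series → Series → Set ℓ
  f ≈ₛ g = ∀ m → f m ≈ g m

  InjectiveOp : (Series → Series) → Set (c Level.⊔ ℓ)
  InjectiveOp F = ∀ f g → F f ≈ₛ F g → f ≈ₛ g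

  Σ< : ℕ → (ℕ → Carrier) → Carrier
  Σ< zero    a = 0#
  Σ< (suc n) a = Σ< n a + a n

  oneₛ : Series
  oneₛ ([] , _)    = 1#
  oneₛ (_ ∷ _ , _) = 0#

  sumVars : Series
  sumVars (m , _) = if isVar m then 1# else 0#

  -- multiplication by the variable x_{i+1}  (0-based index i)
  mulXAux : Series → Maybe (List ℕ) → Carrier
  mulXAux f nothing   = 0#
  mulXAux f (just m') = f (toMon m')

  mulX : ℕ → Series → Series
  mulX i f (m , _) = mulXAux f (decAt i m)

  -- the shift operator S : x_m ↦ x_{m+1} (algebra endomorphism);
  -- coefficient of x₁^0 x₂^e₁ x₃^e₂ ⋯ in S f is the coefficient of
  -- x₁^e₁ x₂^e₂ ⋯ in f, and monomials containing x₁ get coefficient 0.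
  S : Series → Series
  S f ([] , _)               = f ([] , tt)
  S f (zero ∷ [] , ())
  S f (zero ∷ y ∷ r , p)     = f (y ∷ r , p)
  S f (suc _ ∷ _ , _)        = 0#

  S^ : ℕ → Series → Series
  S^ zero    f = f
  S^ (suc n) f = S (S^ n f)

  -- Λ̄ = Σ_{k≥1} x_k S^k.  For a monomial m with exponent list of length n,
  -- only x_1,…,x_n can divide m, so the terms with k > n contribute 0 to
  -- the coefficient of m; the sum below is over k = i+1, i < n.
  Λ̄ : Series → Series
  Λ̄ f (m , p) = Σ< (length m) (λ i → mulX i (S^ (suc i) f) (m , p))

  -- Λ = Σ_{k≥1} x_k S^{k-1}
  Λ : Series → Series
  Λ f (m , p) = Σ< (length m) (λ i → mulX i (S^ i f) (m , p))

-- The coefficient of x₁·m in Λ f is f m: of the terms x_k S^{k-1} f only k = 1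
-- can reach x₁·m, since S^j f involves no x₁ for j ≥ 1.  So Λ is injective, and
-- so is Λ̄ = Λ ∘ S, because S is.  As S 1 = 1 we get Λ̄ 1 = Λ 1; the coefficients
-- of Λ 1 follow from the x₁·m case together with the relation x_{k+1} S = S x_k,
-- which makes every coefficient of Λ g invariant under shifting the monomial.
module Submission where

open import Defs
open import Level using (Level)
open import Algebra.Bundles using (CommutativeRing)
open import Data.Product using (_×_; _,_)
open import Data.Nat using (ℕ; zero; suc)
open import Data.List using (List; []; _∷_; length)
open import Data.Bool using (T)
open import Data.Bool.Properties using (T-irrelevant)
open import Data.Maybe using (just; nothing)
import Data.Maybe as Maybe
open import Data.Unit using (tt)
open import Relation.Binary.PropositionalEquality as ≡ using (_≡_)
import Relation.Binary.Reasoning.Setoid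

norm-normal-≡ : ∀ l → T (normal? l) → norm l ≡ l
norm-normal-≡ []              p  = ≡.refl
norm-normal-≡ (zero ∷ [])     ()
norm-normal-≡ (suc n ∷ [])    p  = ≡.refl
norm-normal-≡ (zero ∷ y ∷ l)  p  = ≡.cong (cons' zero) (norm-normal-≡ (y ∷ l) p)
norm-normal-≡ (suc n ∷ y ∷ l) p  = ≡.cong (cons' (suc n)) (norm-normal-≡ (y ∷ l) p)

toMon-normal : ∀ l (p : T (normal? l)) → toMon l ≡ (l , p)
toMon-normal l p with norm l | norm-normal l | norm-normal-≡ l p
... | _ | q | ≡.refl = ≡.cong (l ,_) (T-irrelevant q p)

incHead : List ℕ → List ℕ
incHead []      = suc zero ∷ []
incHead (e ∷ l) = suc e ∷ l

incHead-normal : ∀ l → T (normal? l) → T (normal? (incHead l))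
incHead-normal []          p = tt
incHead-normal (e ∷ [])    p = tt
incHead-normal (e ∷ y ∷ l) p = p

timesX₁ : Mon → Mon
timesX₁ (l , p) = incHead l , incHead-normal l p

shiftMon : Mon → Mon
shiftMon ([] , p)    = [] , p
shiftMon (e ∷ l , p) = zero ∷ e ∷ l , p

module _ {c ℓ : Level} (R : CommutativeRing c ℓ) where
  open CommutativeRing R hiding (zero)
  open PowerSeries R

  ≡⇒≈ : ∀ {x y} → x ≡ y → x ≈ y
  ≡⇒≈ ≡.refl = refl

  Σ<-cong : ∀ n {a b : ℕ → Carrier} → (∀ i → a i ≈ b i) → Σ< n a ≈ Σ< n b
  Σ<-cong zero    a≈b = refl
  Σ<-cong (suc n) a≈b = +-cong (Σ<-cong n a≈b) (a≈b n)

  Σ<-zeros : ∀ n {a : ℕ → Carrier} → (∀ i → a i ≈ 0#) → Σ< n a ≈ 0#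
  Σ<-zeros zero    a≈0 = refl
  Σ<-zeros (suc n) a≈0 = trans (+-cong (Σ<-zeros n a≈0) (a≈0 n)) (+-identityˡ 0#)

  Σ<-suc : ∀ n (a : ℕ → Carrier) → Σ< (suc n) a ≈ a 0 + Σ< n (λ i → a (suc i))
  Σ<-suc zero    a = trans (+-identityˡ _) (sym (+-identityʳ _))
  Σ<-suc (suc n) a = trans (+-congʳ (Σ<-suc n a)) (+-assoc _ _ _)

  Σ<-head : ∀ n (a : ℕ → Carrier) → (∀ i → a (suc i) ≈ 0#) → Σ< (suc n) a ≈ a 0
  Σ<-head n a tail≈0 =
    trans (Σ<-suc n a) (trans (+-congˡ (Σ<-zeros n tail≈0)) (+-identityʳ _))

  S-cong : ∀ {f g} → f ≈ₛ g → S f ≈ₛ S g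
  S-cong f≈g ([] , _)            = f≈g ([] , tt)
  S-cong f≈g (zero ∷ [] , ())
  S-cong f≈g (zero ∷ y ∷ r , p)  = f≈g (y ∷ r , p)
  S-cong f≈g (suc _ ∷ _ , _)     = refl

  S^-comm-S : ∀ n f → S^ n (S f) ≈ₛ S^ (suc n) f
  S^-comm-S zero    f m = refl
  S^-comm-S (suc n) f   = S-cong (S^-comm-S n f)

  S-shiftMon : ∀ f m → S f (shiftMon m) ≡ f m
  S-shiftMon f ([] , _)    = ≡.refl
  S-shiftMon f (_ ∷ _ , _) = ≡.refl

  S-injective : InjectiveOp S
  S-injective f g Sf≈Sg m =
    trans (≡⇒≈ (≡.sym (S-shiftMon f m))) (trans (Sf≈Sg (shiftMon m)) (≡⇒≈ (S-shiftMon g m)))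

  S-oneₛ : S oneₛ ≈ₛ oneₛ
  S-oneₛ ([] , _)           = refl
  S-oneₛ (zero ∷ [] , ())
  S-oneₛ (zero ∷ _ ∷ _ , _) = refl
  S-oneₛ (suc _ ∷ _ , _)    = refl

  mulX-cong : ∀ i {f g} → f ≈ₛ g → mulX i f ≈ₛ mulX i g
  mulX-cong i f≈g (m , _) with decAt i m
  ... | nothing = refl
  ... | just m′ = f≈g (toMon m′)

  Λ-cong : ∀ {f g} → f ≈ₛ g → Λ f ≈ₛ Λ g
  Λ-cong f≈g (m , p) = Σ<-cong (length m) (λ i → mulX-cong i (S^-cong i) (m , p))
    where
    S^-cong : ∀ n → S^ n _ ≈ₛ S^ n _
    S^-cong zero    = f≈g
    S^-cong (suc n) = S-cong (S^-cong n)

  Λ̄≈Λ∘S : ∀ f → Λ̄ f ≈ₛ Λ (S f)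
  Λ̄≈Λ∘S f (m , p) =
    Σ<-cong (length m) (λ i → mulX-cong i (λ m′ → sym (S^-comm-S i f m′)) (m , p))

  mulX₀-timesX₁ : ∀ f m → mulX 0 f (timesX₁ m) ≈ f m
  mulX₀-timesX₁ f ([] , _)    = refl
  mulX₀-timesX₁ f (e ∷ l , p) = ≡⇒≈ (≡.cong f (toMon-normal (e ∷ l) p))

  VanishesOnX₁ : Series → Set ℓ
  VanishesOnX₁ f = ∀ e l p → f (suc e ∷ l , p) ≈ 0#

  S-vanishesOnX₁ : ∀ f → VanishesOnX₁ (S f)
  S-vanishesOnX₁ f _ _ _ = refl

  mulX-suc-timesX₁ : ∀ {f} → VanishesOnX₁ f → ∀ i m → mulX (suc i) f (timesX₁ m) ≈ 0#
  mulX-suc-timesX₁ {f} f₁≈0 i ([] , _)    = refl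
  mulX-suc-timesX₁ {f} f₁≈0 i (e ∷ l , _) = vanishes (decAt i l)
    where
    vanishes : ∀ mb → mulXAux f (Maybe.map (suc e ∷_) mb) ≈ 0#
    vanishes nothing   = refl
    vanishes (just l′) with norm l′ | norm-normal l′
    ... | []    | q = f₁≈0 e [] q
    ... | y ∷ r | q = f₁≈0 e (y ∷ r) q

  Λ-term : Series → Mon → ℕ → Carrier
  Λ-term f m i = mulX i (S^ i f) m

  Λ-term-suc-timesX₁ : ∀ f m i → Λ-term f (timesX₁ m) (suc i) ≈ 0#
  Λ-term-suc-timesX₁ f m i = mulX-suc-timesX₁ (S-vanishesOnX₁ (S^ i f)) i m

  Λ-timesX₁ : ∀ f m → Λ f (timesX₁ m) ≈ f m
  Λ-timesX₁ f m@([] , _)    =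
    trans (Σ<-head 0 (Λ-term f (timesX₁ m)) (Λ-term-suc-timesX₁ f m)) (mulX₀-timesX₁ f m)
  Λ-timesX₁ f m@(_ ∷ l , _) =
    trans (Σ<-head (length l) (Λ-term f (timesX₁ m)) (Λ-term-suc-timesX₁ f m)) (mulX₀-timesX₁ f m)

  Λ-injective : InjectiveOp Λ
  Λ-injective f g Λf≈Λg m =
    trans (sym (Λ-timesX₁ f m)) (trans (Λf≈Λg (timesX₁ m)) (Λ-timesX₁ g m))

  Λ̄-injective : InjectiveOp Λ̄
  Λ̄-injective f g Λ̄f≈Λ̄g = S-injective f g (Λ-injective (S f) (S g) Λ∘Sf≈Λ∘Sg)
    where
    Λ∘Sf≈Λ∘Sg : Λ (S f) ≈ₛ Λ (S g)
    Λ∘Sf≈Λ∘Sg m = trans (sym (Λ̄≈Λ∘S f m)) (trans (Λ̄f≈Λ̄g m) (Λ̄≈Λ∘S g m))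

  -- The coefficient form of x_{i+2} S = S x_{i+1}.
  mulX-suc-S-shiftMon : ∀ i f m → mulX (suc i) (S f) (shiftMon m) ≈ mulX i f m
  mulX-suc-S-shiftMon i f ([] , _)    = refl
  mulX-suc-S-shiftMon i f (e ∷ l , _) = unshift (decAt i (e ∷ l))
    where
    unshift : ∀ mb → mulXAux (S f) (Maybe.map (zero ∷_) mb) ≈ mulXAux f mb
    unshift nothing   = refl
    unshift (just l′) with norm l′ | norm-normal l′
    ... | []    | _ = refl
    ... | _ ∷ _ | _ = refl

  Λ-shiftMon : ∀ f m → Λ f (shiftMon m) ≈ Λ f m
  Λ-shiftMon f ([] , _)      = refl
  Λ-shiftMon f m@(e ∷ l , _) = begin
    Λ f (shiftMon m)
      ≈⟨ Σ<-suc n (Λ-term f (shiftMon m)) ⟩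
    0# + Σ< n (λ i → Λ-term f (shiftMon m) (suc i))
      ≈⟨ +-identityˡ _ ⟩
    Σ< n (λ i → Λ-term f (shiftMon m) (suc i))
      ≈⟨ Σ<-cong n (λ i → mulX-suc-S-shiftMon i (S^ i f) m) ⟩
    Λ f m ∎
    where
    n = length (e ∷ l)
    open Relation.Binary.Reasoning.Setoid setoid

  -- Every monomial other than 1 is a shift or x₁ times a monomial.
  Λ-oneₛ : Λ oneₛ ≈ₛ sumVars
  Λ-oneₛ ([] , _)                  = refl
  Λ-oneₛ (zero ∷ [] , ())
  Λ-oneₛ (zero ∷ y ∷ r , p)        = trans (Λ-shiftMon oneₛ (y ∷ r , p)) (Λ-oneₛ (y ∷ r , p))
  Λ-oneₛ (suc zero ∷ [] , _)       = Λ-timesX₁ oneₛ ([] , tt)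
  Λ-oneₛ (suc (suc e) ∷ [] , _)    = Λ-timesX₁ oneₛ (suc e ∷ [] , tt)
  Λ-oneₛ (suc zero ∷ y ∷ r , p)    = Λ-timesX₁ oneₛ (zero ∷ y ∷ r , p)
  Λ-oneₛ (suc (suc e) ∷ y ∷ r , p) = Λ-timesX₁ oneₛ (suc e ∷ y ∷ r , p)

  Λ̄-oneₛ : Λ̄ oneₛ ≈ₛ sumVars
  Λ̄-oneₛ m = trans (Λ̄≈Λ∘S oneₛ m) (trans (Λ-cong S-oneₛ m) (Λ-oneₛ m))

lemma7p2 : ∀ {c ℓ : Level} (R : CommutativeRing c ℓ) →
    let open PowerSeries R in
      (InjectiveOp Λ̄ × InjectiveOp Λ)
      × (Λ̄ oneₛ ≈ₛ sumVars × Λ oneₛ ≈ₛ sumVars)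
lemma7p2 R = (Λ̄-injective R , Λ-injective R) , (Λ̄-oneₛ R , Λ-oneₛ R)
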